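{- Let $f(z)=z^d+z^e+c\in\mathbb{Q}[z]$ with integers $d>e\ge2$, $d\ge3$, and $c\in\mathbb{Q}$ with $1<c<2$. If $n\in\mathcal{Z}(f,0)$, then $n\le7$.
   Context: Write $f^n(0)=A_n/B_n$ in lowest terms with $B_n>0$, where $f^n$ is the $n$-th iterate of $f$. A prime $p$ is a primitive prime divisor of $A_n$ if $p\mid A_n$ but $p\nmid A_m$ for all $1\le m<n$. $\mathcal{Z}(f,0)=\{n\ge1: A_n\text{ has no primitive prime divisor}\}$. -}

module Defs where

open import Data.Nat as ℕ using (ℕ; zero; suc)
open import Data.Nat.Divisibility using (_∣_)
open import Data.Nat.Primality using (Prime)
open import Data.Integer as ℤ using (ℤ; +_)
open import Data.Rational using (ℚ; _+_; _*_; 0ℚ; 1ℚ; ↥_)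
open import Data.Product using (_×_)
open import Relation.Nullary using (¬_)

_^ℚ_ : ℚ → ℕ → ℚ
x ^ℚ zero  = 1ℚ
x ^ℚ suc k = x * (x ^ℚ k)

iter : {A : Set} → (A → A) → ℕ → A → A
iter f zero    x = x
iter f (suc n) x = f (iter f n x)

poly : ℕ → ℕ → ℚ → ℚ → ℚ
poly d e c z = (z ^ℚ d) + (z ^ℚ e) + c

-- A_n : numerator of f^n(0) in lowest terms (ℚ is normalised, denominator > 0)
A : (ℚ → ℚ) → ℕ → ℤ
A f n = ↥ (iter f n 0ℚ)

PrimitivePrimeDivisor : (ℚ → ℚ) → ℕ → ℕ → Set
PrimitivePrimeDivisor f n p =
  Prime p × (p ∣ (ℤ.∣ A f n ∣)) × (∀ m → 1 ℕ.≤ m → m ℕ.< n → ¬ (p ∣ (ℤ.∣ A f m ∣)))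

InZ : (ℚ → ℚ) → ℕ → Set
InZ f n = (1 ℕ.≤ n) × (∀ p → ¬ PrimitivePrimeDivisor f n p)

-- Write c = a / b in lowest terms; c > 1 means a ≥ 2.  Then f^(σ+1)(0) = U σ / B σ in lowest
-- terms, with B σ = b ^ d ^ σ and U (σ+1) = U σ ^ d + U σ ^ e B σ ^ (d - e) + a B σ ^ d / b.
-- Put Δ σ τ = U σ B τ - U τ B σ.  Since x - y ∣ x ^ k - y ^ k, Δ σ τ ∣ Δ (σ+1) (τ+1), and
-- Δ (μ+1) 0 is a multiple of U μ ^ e, hence of G² whenever G ∣ U μ (as e ≥ 2).  Let μ be the first
-- index with p ∣ U μ and let p ^ j exactly divide U μ.  Then p ^ (j+1) ∣ (p ^ j)² divides every
-- Δ (τ + μ + 1) τ, so p ^ (j+1) ∣ U ν would give p ^ (j+1) ∣ U (ν mod (μ+1)), contradicting the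
-- choice of μ and j.  Thus every prime power dividing some U ν already divides U μ, and a U σ
-- without primitive prime divisor divides U 0 ⋯ U (σ-1).  That is impossible, since a ≥ 2 makes
-- this product smaller than U σ ≥ U (σ-1) ^ d.  So 𝒵(f,0) is empty.

module Submission where

open import Defs
open import Data.Empty using (⊥; ⊥-elim)
open import Data.List using (_∷_)
open import Data.List.Relation.Unary.All using (_∷_)
open import Data.Nat
  using ( ℕ; zero; suc; _+_; _*_; _^_; _∸_; _≤_; _<_; _≥_; z≤n; s≤s
        ; NonZero; NonTrivial; >-nonZero; _≟_)
open import Data.Nat.Properties
open import Data.Nat.Divisibility
open import Data.Nat.DivMod as ℕ using (_%_; m≡m%n+[m/n]*n; m%n<n)
open import Data.Nat.Coprimality as Coprimality using (Coprime; coprime-divisor; recompute)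
open import Data.Nat.Induction using (<-rec)
open import Data.Nat.ListAction using (product)
open import Data.Nat.Primality
open import Data.Nat.Primality.Factorisation using (factorise)
open import Data.Nat.Tactic.RingSolver using (solve-∀)
open import Data.Integer as ℤ using (ℤ; +_)
import Data.Integer.Properties as ℤ
import Data.Integer.Divisibility.Signed as ℤ
import Data.Integer.Tactic.RingSolver as ℤ-Solver
open import Data.Rational as ℚ using (ℚ; mkℚ; 0ℚ; 1ℚ; toℚᵘ; _/_) renaming (_<_ to _<ℚ_)
import Data.Rational.Properties as ℚ
open import Data.Rational.Unnormalised as ℚᵘ using (ℚᵘ; mkℚᵘ; *≡*)
open import Data.Product using (∃-syntax; _×_; _,_)
open import Data.Sum using (_⊎_; inj₁; inj₂; [_,_]′)
open import Level using (0ℓ)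
open import Relation.Nullary using (¬_; yes; no)
open import Relation.Unary using (Pred; Decidable)
open import Relation.Binary.PropositionalEquality
open import Algebra.Properties.CommutativeSemigroup ℤ.*-commutativeSemigroup
  using (interchange; xy∙z≈xz∙y)

^-distribʳ-* : ∀ m n k → (m * n) ^ k ≡ m ^ k * n ^ k
^-distribʳ-* m n zero    = refl
^-distribʳ-* m n (suc k) = begin
  m * n * (m * n) ^ k     ≡⟨ cong (m * n *_) (^-distribʳ-* m n k) ⟩
  m * n * (m ^ k * n ^ k) ≡⟨ [m*n]*[o*p]≡[m*o]*[n*p] m n (m ^ k) (n ^ k) ⟩
  m * m ^ k * (n * n ^ k) ∎
  where open ≡-Reasoning

^-monoʳ-∣ : ∀ m {i j} → i ≤ j → m ^ i ∣ m ^ j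
^-monoʳ-∣ m {i} {j} i≤j = divides (m ^ (j ∸ i)) (begin
  m ^ j               ≡⟨ cong (m ^_) (m+[n∸m]≡n i≤j) ⟨
  m ^ (i + (j ∸ i))   ≡⟨ ^-distribˡ-+-* m i (j ∸ i) ⟩
  m ^ i * m ^ (j ∸ i) ≡⟨ *-comm (m ^ i) _ ⟩
  m ^ (j ∸ i) * m ^ i ∎)
  where open ≡-Reasoning

m*m∣m^n : ∀ m {n} → 2 ≤ n → m * m ∣ m ^ n
m*m∣m^n m {suc (suc n)} (s≤s (s≤s _)) = subst (m * m ∣_) (*-assoc m m (m ^ n)) (m∣m*n (m ^ n))

m*m≤m^n : ∀ m .{{_ : NonZero m}} {n} → 2 ≤ n → m * m ≤ m ^ n
m*m≤m^n m {suc (suc n)} (s≤s (s≤s _)) = *-monoʳ-≤ m (m≤m*n m (m ^ n) {{m^n≢0 m n}})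

m∣m^n : ∀ m {n} → 1 ≤ n → m ∣ m ^ n
m∣m^n m {suc n} _ = m∣m*n (m ^ n)

coprime-∣ˡ : ∀ {k m n} → k ∣ m → Coprime m n → Coprime k n
coprime-∣ˡ k∣m m⊥n (i∣k , i∣n) = m⊥n (∣-trans i∣k k∣m , i∣n)

coprime-*ˡ : ∀ {m o n} → Coprime m n → Coprime o n → Coprime (m * o) n
coprime-*ˡ {m} m⊥n o⊥n {i} (i∣mo , i∣n) = o⊥n (coprime-divisor i⊥m i∣mo , i∣n)
  where
  i⊥m : Coprime i m
  i⊥m (j∣i , j∣m) = m⊥n (j∣m , ∣-trans j∣i i∣n)

coprime-^ˡ : ∀ {m n} k → Coprime m n → Coprime (m ^ k) n
coprime-^ˡ zero    _   (i∣1 , _) = ∣1⇒≡1 i∣1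
coprime-^ˡ (suc k) m⊥n = coprime-*ˡ m⊥n (coprime-^ˡ k m⊥n)

coprime-^ʳ : ∀ {m n} k → Coprime m n → Coprime m (n ^ k)
coprime-^ʳ k m⊥n = Coprimality.sym (coprime-^ˡ k (Coprimality.sym m⊥n))

distinct-primes-coprime : ∀ {p q} → Prime p → Prime q → p ≢ q → Coprime p q
distinct-primes-coprime pp pq p≢q {i} (i∣p , i∣q) with prime⇒irreducible pp i∣p
... | inj₁ i≡1 = i≡1
... | inj₂ refl with prime⇒irreducible pq i∣q
...   | inj₁ p≡1 = p≡1
...   | inj₂ p≡q = ⊥-elim (p≢q p≡q)

prime-factor : ∀ n → 2 ≤ n → ∃[ p ] Prime p × p ∣ n
prime-factor n@(suc (suc _)) (s≤s (s≤s _)) with factorise n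
... | record { factors = p ∷ ps ; isFactorisation = n≡∏ ; factorsPrime = pp ∷ _ } =
  p , pp , subst (p ∣_) (sym n≡∏) (m∣m*n (product ps))

PrimePowersOf_Divide_ : ℕ → ℕ → Set
PrimePowersOf N Divide P = ∀ p i → Prime p → p ^ i ∣ N → p ^ i ∣ P

cancel-prime : ∀ {p M P} → Prime p →
  PrimePowersOf (p * M) Divide (p * P) → PrimePowersOf M Divide P
cancel-prime {p} pp all-∣ q i pq qⁱ∣M with q ≟ p
... | yes refl = *-cancelˡ-∣ p {{prime⇒nonZero pp}} (all-∣ p (suc i) pp (*-monoʳ-∣ p qⁱ∣M))
... | no q≢p = coprime-divisor (coprime-^ˡ i (distinct-primes-coprime pq pp q≢p))
                 (all-∣ q i pq (∣-trans qⁱ∣M (n∣m*n p)))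

prime-powers⇒∣ : ∀ N P → NonZero N → PrimePowersOf N Divide P → N ∣ P
prime-powers⇒∣ = <-rec _ divides-by-descent
  where
  divides-by-descent : ∀ N → (∀ {M} → M < N → ∀ P → NonZero M → PrimePowersOf M Divide P → M ∣ P) →
    ∀ P → NonZero N → PrimePowersOf N Divide P → N ∣ P
  divides-by-descent 1 _ P _ _ = 1∣ P
  divides-by-descent N@(suc (suc _)) smaller P _ all-∣
    with p , pp , p∣N ← prime-factor N (s≤s (s≤s z≤n)) =
    subst₂ _∣_ (sym N≡pM) (sym P≡pP′) (*-monoʳ-∣ p M∣P′)
    where
    instance
      p-nonTrivial : NonTrivial p
      p-nonTrivial = prime⇒nonTrivial pp
    p∣P : p ∣ P
    p∣P = subst (_∣ P) (^-identityʳ p) (all-∣ p 1 pp (subst (_∣ N) (sym (^-identityʳ p)) p∣N))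
    M P′ : ℕ
    M = quotient p∣N
    P′ = quotient p∣P
    N≡pM : N ≡ p * M
    N≡pM = m∣n⇒n≡m*quotient p∣N
    P≡pP′ : P ≡ p * P′
    P≡pP′ = m∣n⇒n≡m*quotient p∣P
    M∣P′ : M ∣ P′
    M∣P′ = smaller (quotient-< p∣N) P′ (quotient≢0 p∣N)
      (cancel-prime pp (subst₂ PrimePowersOf_Divide_ N≡pM P≡pP′ all-∣))

exact-power : ∀ {p n} i → ¬ p ^ i ∣ n → ∃[ j ] j < i × p ^ j ∣ n × ¬ p ^ suc j ∣ n
exact-power {n = n} zero p⁰∤n = ⊥-elim (p⁰∤n (1∣ n))
exact-power {p} {n} (suc i) pⁱ⁺¹∤n with p ^ i ∣? n
... | yes pⁱ∣n = i , n<1+n i , pⁱ∣n , pⁱ⁺¹∤n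
... | no pⁱ∤n with j , j<i , pʲ∣n , pʲ⁺¹∤n ← exact-power i pⁱ∤n =
  j , m<n⇒m<1+n j<i , pʲ∣n , pʲ⁺¹∤n

IsLeast : Pred ℕ 0ℓ → ℕ → Set
IsLeast P m = P m × (∀ {k} → k < m → ¬ P k)

least-or-none : ∀ {P : Pred ℕ 0ℓ} → Decidable P → ∀ n →
  (∃[ m ] m < n × IsLeast P m) ⊎ (∀ {k} → k < n → ¬ P k)
least-or-none P? zero = inj₂ λ ()
least-or-none P? (suc n) with least-or-none P? n
... | inj₁ (m , m<n , least) = inj₁ (m , m<n⇒m<1+n m<n , least)
... | inj₂ none with P? n
...   | yes Pn = inj₁ (n , n<1+n n , Pn , none)
...   | no ¬Pn = inj₂ λ k<1+n → [ none , (λ { refl → ¬Pn }) ]′ (m<1+n⇒m<n∨m≡n k<1+n)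

m-n∣m^k-n^k : ∀ m n k → + m ℤ.- + n ℤ.∣ + (m ^ k) ℤ.- + (n ^ k)
m-n∣m^k-n^k m n zero = subst (+ m ℤ.- + n ℤ.∣_) (ℤ.*-zeroʳ (+ m ℤ.- + n)) (ℤ.∣m⇒∣m*n (+ 0) ℤ.∣-refl)
m-n∣m^k-n^k m n (suc k) = subst (+ m ℤ.- + n ℤ.∣_) (sym split)
  (ℤ.∣m∣n⇒∣m+n (ℤ.∣n⇒∣m*n (+ m) (m-n∣m^k-n^k m n k)) (ℤ.∣m⇒∣m*n (+ (n ^ k)) ℤ.∣-refl))
  where
  split : + (m * m ^ k) ℤ.- + (n * n ^ k) ≡
          + m ℤ.* (+ (m ^ k) ℤ.- + (n ^ k)) ℤ.+ (+ m ℤ.- + n) ℤ.* + (n ^ k)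
  split = trans (cong₂ ℤ._-_ (ℤ.pos-* m (m ^ k)) (ℤ.pos-* n (n ^ k)))
                (telescope (+ m) (+ n) (+ (m ^ k)) (+ (n ^ k)))
    where
    telescope : ∀ x y a b → x ℤ.* a ℤ.- y ℤ.* b ≡ x ℤ.* (a ℤ.- b) ℤ.+ (x ℤ.- y) ℤ.* b
    telescope = ℤ-Solver.solve-∀

infix 4 _≃ᵘ_÷_ _≃_÷_

-- q = N / D by cross-multiplication, so N / D need not be in lowest terms.

record _≃ᵘ_÷_ (q : ℚᵘ) (N D : ℕ) : Set where
  constructor fraction
  field cross : ℚᵘ.↥ q ℤ.* + D ≡ + N ℤ.* ℚᵘ.↧ q

≃ᵘ÷-respˡ-≃ : ∀ {p q N D} → p ℚᵘ.≃ q → q ≃ᵘ N ÷ D → p ≃ᵘ N ÷ D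
≃ᵘ÷-respˡ-≃ {p} {q} {N} {D} (*≡* p≃q) (fraction q≃N/D) =
  fraction (ℤ.*-cancelʳ-≡ _ _ (ℚᵘ.↧ q) (begin
    ↥p ℤ.* + D ℤ.* ↧q  ≡⟨ xy∙z≈xz∙y ↥p (+ D) ↧q ⟩
    ↥p ℤ.* ↧q ℤ.* + D  ≡⟨ cong (ℤ._* + D) p≃q ⟩
    ↥q ℤ.* ↧p ℤ.* + D  ≡⟨ xy∙z≈xz∙y ↥q ↧p (+ D) ⟩
    ↥q ℤ.* + D ℤ.* ↧p  ≡⟨ cong (ℤ._* ↧p) q≃N/D ⟩
    + N ℤ.* ↧q ℤ.* ↧p  ≡⟨ xy∙z≈xz∙y (+ N) ↧q ↧p ⟩
    + N ℤ.* ↧p ℤ.* ↧q  ∎))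
  where
  open ≡-Reasoning
  ↥p ↧p ↥q ↧q : ℤ
  ↥p = ℚᵘ.↥ p
  ↧p = ℚᵘ.↧ p
  ↥q = ℚᵘ.↥ q
  ↧q = ℚᵘ.↧ q

*-≃ᵘ÷ : ∀ {p q N D M E} → p ≃ᵘ N ÷ D → q ≃ᵘ M ÷ E → p ℚᵘ.* q ≃ᵘ N * M ÷ D * E
*-≃ᵘ÷ {p@(mkℚᵘ _ _)} {q@(mkℚᵘ _ _)} {N} {D} {M} {E} (fraction p≃N/D) (fraction q≃M/E) =
  fraction (begin
    ↥p ℤ.* ↥q ℤ.* + (D * E)        ≡⟨ cong (↥p ℤ.* ↥q ℤ.*_) (ℤ.pos-* D E) ⟩
    ↥p ℤ.* ↥q ℤ.* (+ D ℤ.* + E)    ≡⟨ interchange ↥p ↥q (+ D) (+ E) ⟩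
    ↥p ℤ.* + D ℤ.* (↥q ℤ.* + E)    ≡⟨ cong₂ ℤ._*_ p≃N/D q≃M/E ⟩
    + N ℤ.* ↧p ℤ.* (+ M ℤ.* ↧q)    ≡⟨ interchange (+ N) ↧p (+ M) ↧q ⟩
    + N ℤ.* + M ℤ.* (↧p ℤ.* ↧q)
      ≡⟨ cong₂ ℤ._*_ (ℤ.pos-* N M) (ℤ.pos-* (ℚᵘ.↧ₙ p) (ℚᵘ.↧ₙ q)) ⟨
    + (N * M) ℤ.* ℚᵘ.↧ (p ℚᵘ.* q)  ∎)
  where
  open ≡-Reasoning
  ↥p ↧p ↥q ↧q : ℤ
  ↥p = ℚᵘ.↥ p
  ↧p = ℚᵘ.↧ p
  ↥q = ℚᵘ.↥ q
  ↧q = ℚᵘ.↧ q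

+-≃ᵘ÷ : ∀ {p q N D M E} → p ≃ᵘ N ÷ D → q ≃ᵘ M ÷ E →
  p ℚᵘ.+ q ≃ᵘ N * E + M * D ÷ D * E
+-≃ᵘ÷ {p@(mkℚᵘ _ _)} {q@(mkℚᵘ _ _)} {N} {D} {M} {E} (fraction p≃N/D) (fraction q≃M/E) =
  fraction (begin
    (↥p ℤ.* ↧q ℤ.+ ↥q ℤ.* ↧p) ℤ.* + (D * E)
      ≡⟨ cong ((↥p ℤ.* ↧q ℤ.+ ↥q ℤ.* ↧p) ℤ.*_) (ℤ.pos-* D E) ⟩
    (↥p ℤ.* ↧q ℤ.+ ↥q ℤ.* ↧p) ℤ.* (+ D ℤ.* + E)
      ≡⟨ expand ↥p ↥q ↧p ↧q (+ D) (+ E) ⟩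
    ↥p ℤ.* + D ℤ.* (↧q ℤ.* + E) ℤ.+ ↥q ℤ.* + E ℤ.* (↧p ℤ.* + D)
      ≡⟨ cong₂ (λ u v → u ℤ.* (↧q ℤ.* + E) ℤ.+ v ℤ.* (↧p ℤ.* + D)) p≃N/D q≃M/E ⟩
    + N ℤ.* ↧p ℤ.* (↧q ℤ.* + E) ℤ.+ + M ℤ.* ↧q ℤ.* (↧p ℤ.* + D)
      ≡⟨ collect (+ N) (+ M) ↧p ↧q (+ D) (+ E) ⟩
    (+ N ℤ.* + E ℤ.+ + M ℤ.* + D) ℤ.* (↧p ℤ.* ↧q)
      ≡⟨ cong₂ ℤ._*_
           (trans (ℤ.pos-+ (N * E) (M * D)) (cong₂ ℤ._+_ (ℤ.pos-* N E) (ℤ.pos-* M D)))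
           (ℤ.pos-* (ℚᵘ.↧ₙ p) (ℚᵘ.↧ₙ q)) ⟨
    + (N * E + M * D) ℤ.* ℚᵘ.↧ (p ℚᵘ.+ q) ∎)
  where
  open ≡-Reasoning
  ↥p ↧p ↥q ↧q : ℤ
  ↥p = ℚᵘ.↥ p
  ↧p = ℚᵘ.↧ p
  ↥q = ℚᵘ.↥ q
  ↧q = ℚᵘ.↧ q
  expand : ∀ a b c d x y →
    (a ℤ.* d ℤ.+ b ℤ.* c) ℤ.* (x ℤ.* y) ≡ a ℤ.* x ℤ.* (d ℤ.* y) ℤ.+ b ℤ.* y ℤ.* (c ℤ.* x)
  expand = ℤ-Solver.solve-∀
  collect : ∀ a b c d x y →
    a ℤ.* c ℤ.* (d ℤ.* y) ℤ.+ b ℤ.* d ℤ.* (c ℤ.* x) ≡ (a ℤ.* y ℤ.+ b ℤ.* x) ℤ.* (c ℤ.* d)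
  collect = ℤ-Solver.solve-∀

_≃_÷_ : ℚ → ℕ → ℕ → Set
x ≃ N ÷ D = toℚᵘ x ≃ᵘ N ÷ D

*-≃÷ : ∀ {x y N D M E} → x ≃ N ÷ D → y ≃ M ÷ E → x ℚ.* y ≃ N * M ÷ D * E
*-≃÷ {x} {y} x≃N/D y≃M/E = ≃ᵘ÷-respˡ-≃ (ℚ.toℚᵘ-homo-* x y) (*-≃ᵘ÷ x≃N/D y≃M/E)

+-≃÷ : ∀ {x y N D M E} → x ≃ N ÷ D → y ≃ M ÷ E → x ℚ.+ y ≃ N * E + M * D ÷ D * E
+-≃÷ {x} {y} x≃N/D y≃M/E = ≃ᵘ÷-respˡ-≃ (ℚ.toℚᵘ-homo-+ x y) (+-≃ᵘ÷ x≃N/D y≃M/E)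

^-≃÷ : ∀ {x N D} → x ≃ N ÷ D → ∀ k → x ^ℚ k ≃ N ^ k ÷ D ^ k
^-≃÷ x≃N/D zero    = fraction refl
^-≃÷ x≃N/D (suc k) = *-≃÷ x≃N/D (^-≃÷ x≃N/D k)

≃÷-rescale : ∀ {x N D N′ D′} .{{_ : NonZero D}} → x ≃ N ÷ D → N * D′ ≡ N′ * D → x ≃ N′ ÷ D′
≃÷-rescale {x@(mkℚ _ _ _)} {N} {D} {N′} {D′} (fraction x≃N/D) ND′≡N′D =
  fraction (ℤ.*-cancelʳ-≡ _ _ (+ D) (begin
    ↥x ℤ.* + D′ ℤ.* + D   ≡⟨ xy∙z≈xz∙y ↥x (+ D′) (+ D) ⟩
    ↥x ℤ.* + D ℤ.* + D′   ≡⟨ cong (ℤ._* + D′) x≃N/D ⟩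
    + N ℤ.* ↧x ℤ.* + D′   ≡⟨ xy∙z≈xz∙y (+ N) ↧x (+ D′) ⟩
    + N ℤ.* + D′ ℤ.* ↧x   ≡⟨ cong (ℤ._* ↧x) ND′≡N′D-in-ℤ ⟩
    + N′ ℤ.* + D ℤ.* ↧x   ≡⟨ xy∙z≈xz∙y (+ N′) (+ D) ↧x ⟩
    + N′ ℤ.* ↧x ℤ.* + D   ∎))
  where
  open ≡-Reasoning
  ↥x ↧x : ℤ
  ↥x = ℚ.↥ x
  ↧x = ℚ.↧ x
  ND′≡N′D-in-ℤ : + N ℤ.* + D′ ≡ + N′ ℤ.* + D
  ND′≡N′D-in-ℤ = trans (sym (ℤ.pos-* N D′)) (trans (cong +_ ND′≡N′D) (ℤ.pos-* N′ D))

≃÷⇒∣↥∣≡ : ∀ {x N D} .{{_ : NonZero D}} → x ≃ N ÷ D → Coprime N D → ℤ.∣ ℚ.↥ x ∣ ≡ N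
≃÷⇒∣↥∣≡ {x@(mkℚ _ _ _)} {N} {suc D-1} (fraction x≃N/D) N⊥D =
  cong (λ y → ℤ.∣ ℚ.↥ y ∣) (ℚ.≃⇒≡ {x} {mkℚ (+ N) D-1 N⊥D} (ℚ.*≡* x≃N/D))

poly-≃÷ : ∀ d e {c a b x N D} → x ≃ N ÷ D → c ≃ a ÷ b →
  poly d e c x ≃ (N ^ d * D ^ e + N ^ e * D ^ d) * b + a * (D ^ d * D ^ e)
               ÷ D ^ d * D ^ e * b
poly-≃÷ d e x≃N/D c≃a/b = +-≃÷ (+-≃÷ (^-≃÷ x≃N/D d) (^-≃÷ x≃N/D e)) c≃a/b

poly-0 : ∀ {d e} c → 1 ≤ d → 1 ≤ e → poly d e c 0ℚ ≡ c
poly-0 {suc d} {suc e} c (s≤s _) (s≤s _) = begin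
  0ℚ ℚ.* 0ℚ ^ℚ d ℚ.+ 0ℚ ℚ.* 0ℚ ^ℚ e ℚ.+ c
    ≡⟨ cong₂ (λ u v → u ℚ.+ v ℚ.+ c) (ℚ.*-zeroˡ (0ℚ ^ℚ d)) (ℚ.*-zeroˡ (0ℚ ^ℚ e)) ⟩
  0ℚ ℚ.+ 0ℚ ℚ.+ c
    ≡⟨ ℚ.+-identityˡ c ⟩
  c ∎
  where open ≡-Reasoning

module Sequence (d e a b : ℕ) (2≤e : 2 ≤ e) (e<d : e < d) .{{_ : NonZero b}} where

  r : ℕ
  r = d ∸ e

  1≤r : 1 ≤ r
  1≤r = m<n⇒0<n∸m e<d

  2≤d : 2 ≤ d
  2≤d = ≤-trans 2≤e (<⇒≤ e<d)

  instance
    d≢0 : NonZero d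
    d≢0 = >-nonZero (≤-trans (s≤s z≤n) 2≤d)

  ^d≡^e*^r : ∀ m → m ^ d ≡ m ^ e * m ^ r
  ^d≡^e*^r m = trans (cong (m ^_) (sym (m+[n∸m]≡n (<⇒≤ e<d)))) (^-distribˡ-+-* m e r)

  -- T σ = B σ ^ d / b, and f^(σ+1)(0) = U σ / B σ when c = a / b (iter-≃÷).
  B : ℕ → ℕ
  B σ = b ^ d ^ σ

  T : ℕ → ℕ
  T σ = b ^ (d ^ suc σ ∸ 1)

  U : ℕ → ℕ
  U zero    = a
  U (suc σ) = U σ ^ d + U σ ^ e * B σ ^ r + a * T σ

  B≢0 : ∀ σ → NonZero (B σ)
  B≢0 σ = m^n≢0 b (d ^ σ)

  B-suc : ∀ σ → B (suc σ) ≡ B σ ^ d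
  B-suc σ = trans (cong (b ^_) (*-comm d (d ^ σ))) (sym (^-*-assoc b (d ^ σ) d))

  b*T≡B^d : ∀ σ → b * T σ ≡ B σ ^ d
  b*T≡B^d σ = trans (cong (b ^_) (m+[n∸m]≡n (m^n>0 d (suc σ)))) (B-suc σ)

  T*B^d-comm : ∀ σ τ → T σ * B τ ^ d ≡ T τ * B σ ^ d
  T*B^d-comm σ τ = *-cancelˡ-≡ _ _ b (begin
    b * (T σ * B τ ^ d)  ≡⟨ *-assoc b (T σ) _ ⟨
    b * T σ * B τ ^ d    ≡⟨ cong (_* B τ ^ d) (b*T≡B^d σ) ⟩
    B σ ^ d * B τ ^ d    ≡⟨ *-comm (B σ ^ d) _ ⟩
    B τ ^ d * B σ ^ d    ≡⟨ cong (_* B σ ^ d) (b*T≡B^d τ) ⟨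
    b * T τ * B σ ^ d    ≡⟨ *-assoc b (T τ) _ ⟩
    b * (T τ * B σ ^ d)  ∎)
    where open ≡-Reasoning

  iter-≃÷ : ∀ {c} → c ≃ a ÷ b → ∀ σ → iter (poly d e c) (suc σ) 0ℚ ≃ U σ ÷ B σ
  iter-≃÷ {c} c≃a/b zero =
    ≃÷-rescale (subst (_≃ a ÷ b) (sym (poly-0 c 1≤d 1≤e)) c≃a/b) (cong (a *_) (^-identityʳ b))
    where
    1≤d : 1 ≤ d
    1≤d = ≤-trans (s≤s z≤n) 2≤d
    1≤e : 1 ≤ e
    1≤e = ≤-trans (s≤s z≤n) 2≤e
  iter-≃÷ {c} c≃a/b (suc σ) = ≃÷-rescale (poly-≃÷ d e (iter-≃÷ c≃a/b σ) c≃a/b)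
    (trans (cong (numerator *_) (B-suc σ))
      (rescale (U σ ^ d) (U σ ^ e) (B σ ^ e) (B σ ^ r) (T σ) (B σ ^ d)
               (^d≡^e*^r (B σ)) (b*T≡B^d σ)))
    where
    numerator : ℕ
    numerator = (U σ ^ d * B σ ^ e + U σ ^ e * B σ ^ d) * b + a * (B σ ^ d * B σ ^ e)
    instance
      Bσ≢0 : NonZero (B σ)
      Bσ≢0 = B≢0 σ
      denominator≢0 : NonZero (B σ ^ d * B σ ^ e * b)
      denominator≢0 = m*n≢0 _ b {{m*n≢0 _ _ {{m^n≢0 (B σ) d}} {{m^n≢0 (B σ) e}}}}
    rescale : ∀ Nᵈ Nᵉ Xᵉ Xʳ t W → W ≡ Xᵉ * Xʳ → b * t ≡ W →
      ((Nᵈ * Xᵉ + Nᵉ * W) * b + a * (W * Xᵉ)) * W ≡ (Nᵈ + Nᵉ * Xʳ + a * t) * (W * Xᵉ * b)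
    rescale Nᵈ Nᵉ Xᵉ Xʳ t _ refl b*t≡W = trans
      (cong (λ w → ((Nᵈ * Xᵉ + Nᵉ * (Xᵉ * Xʳ)) * b + a * (w * Xᵉ)) * (Xᵉ * Xʳ)) (sym b*t≡W))
      (expand Nᵈ Nᵉ Xᵉ Xʳ t a b)
      where
      expand : ∀ x y u v t a b → ((x * u + y * (u * v)) * b + a * (b * t * u)) * (u * v) ≡
                                 (x + y * v + a * t) * (u * v * u * b)
      expand = solve-∀

  U-suc*B-suc : ∀ σ τ → U (suc σ) * B (suc τ) ≡
    (U σ * B τ) ^ d + (B σ * B τ) ^ r * (U σ * B τ) ^ e + a * (T σ * B τ ^ d)
  U-suc*B-suc σ τ = begin
    (Nᵈ + Nᵉ * Xʳ + a * T σ) * B (suc τ)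
      ≡⟨ cong ((Nᵈ + Nᵉ * Xʳ + a * T σ) *_) (B-suc τ) ⟩
    (Nᵈ + Nᵉ * Xʳ + a * T σ) * Yᵈ
      ≡⟨ distrib Nᵈ Nᵉ Xʳ a (T σ) Yᵈ ⟩
    Nᵈ * Yᵈ + Nᵉ * Xʳ * Yᵈ + a * (T σ * Yᵈ)
      ≡⟨ cong (λ y → Nᵈ * Yᵈ + Nᵉ * Xʳ * y + a * (T σ * Yᵈ)) (^d≡^e*^r (B τ)) ⟩
    Nᵈ * Yᵈ + Nᵉ * Xʳ * (B τ ^ e * B τ ^ r) + a * (T σ * Yᵈ)
      ≡⟨ cong (λ y → Nᵈ * Yᵈ + y + a * (T σ * Yᵈ)) (regroup Nᵉ Xʳ (B τ ^ e) (B τ ^ r)) ⟩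
    Nᵈ * Yᵈ + Xʳ * B τ ^ r * (Nᵉ * B τ ^ e) + a * (T σ * Yᵈ)
      ≡⟨ cong₂ (λ x y → x + y + a * (T σ * Yᵈ)) (^-distribʳ-* (U σ) (B τ) d)
           (cong₂ _*_ (^-distribʳ-* (B σ) (B τ) r) (^-distribʳ-* (U σ) (B τ) e)) ⟨
    (U σ * B τ) ^ d + (B σ * B τ) ^ r * (U σ * B τ) ^ e + a * (T σ * B τ ^ d) ∎
    where
    open ≡-Reasoning
    Nᵈ Nᵉ Xʳ Yᵈ : ℕ
    Nᵈ = U σ ^ d
    Nᵉ = U σ ^ e
    Xʳ = B σ ^ r
    Yᵈ = B τ ^ d
    distrib : ∀ x y z a t w → (x + y * z + a * t) * w ≡ x * w + y * z * w + a * (t * w)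
    distrib = solve-∀
    regroup : ∀ x y z w → x * y * (z * w) ≡ y * w * (x * z)
    regroup = solve-∀

  U-suc*B₀ : ∀ μ → U (suc μ) * B 0 ≡ a * B (suc μ) + U μ ^ e * ((U μ ^ r + B μ ^ r) * b)
  U-suc*B₀ μ = begin
    (U μ ^ d + U μ ^ e * B μ ^ r + a * T μ) * (b * 1)
      ≡⟨ cong (λ x → (x + U μ ^ e * B μ ^ r + a * T μ) * (b * 1)) (^d≡^e*^r (U μ)) ⟩
    (U μ ^ e * U μ ^ r + U μ ^ e * B μ ^ r + a * T μ) * (b * 1)
      ≡⟨ factor (U μ ^ e) (U μ ^ r) (B μ ^ r) a (T μ) b ⟩
    a * (b * T μ) + U μ ^ e * ((U μ ^ r + B μ ^ r) * b)
      ≡⟨ cong (λ x → a * x + U μ ^ e * ((U μ ^ r + B μ ^ r) * b))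
              (trans (b*T≡B^d μ) (sym (B-suc μ))) ⟩
    a * B (suc μ) + U μ ^ e * ((U μ ^ r + B μ ^ r) * b) ∎
    where
    open ≡-Reasoning
    factor : ∀ x u v a t b → (x * u + x * v + a * t) * (b * 1) ≡ a * (b * t) + x * ((u + v) * b)
    factor = solve-∀

  Δ : ℕ → ℕ → ℤ
  Δ σ τ = + (U σ * B τ) ℤ.- + (U τ * B σ)

  Δ∣Δ-suc : ∀ σ τ → Δ σ τ ℤ.∣ Δ (suc σ) (suc τ)
  Δ∣Δ-suc σ τ = subst (Δ σ τ ℤ.∣_) (sym Δ-suc≡)
    (ℤ.∣m∣n⇒∣m+n (m-n∣m^k-n^k P Q d) (ℤ.∣n⇒∣m*n (+ W) (m-n∣m^k-n^k P Q e)))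
    where
    P Q W C : ℕ
    P = U σ * B τ
    Q = U τ * B σ
    W = (B σ * B τ) ^ r
    C = a * (T σ * B τ ^ d)
    pos-difference : ∀ x y x′ y′ →
      + (x + W * y + C) ℤ.- + (x′ + W * y′ + C) ≡ (+ x ℤ.- + x′) ℤ.+ + W ℤ.* (+ y ℤ.- + y′)
    pos-difference x y x′ y′ = trans (cong₂ ℤ._-_ (cast x y) (cast x′ y′))
      (cancel (+ x) (+ y) (+ x′) (+ y′) (+ W) (+ C))
      where
      cast : ∀ x y → + (x + W * y + C) ≡ + x ℤ.+ + W ℤ.* + y ℤ.+ + C
      cast x y = trans (ℤ.pos-+ (x + W * y) C)
        (cong (ℤ._+ + C) (trans (ℤ.pos-+ x (W * y)) (cong (ℤ._+_ (+ x)) (ℤ.pos-* W y))))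
      cancel : ∀ x y x′ y′ w c →
        (x ℤ.+ w ℤ.* y ℤ.+ c) ℤ.- (x′ ℤ.+ w ℤ.* y′ ℤ.+ c) ≡ (x ℤ.- x′) ℤ.+ w ℤ.* (y ℤ.- y′)
      cancel = ℤ-Solver.solve-∀
    Δ-suc≡ : Δ (suc σ) (suc τ) ≡ (+ (P ^ d) ℤ.- + (Q ^ d)) ℤ.+ + W ℤ.* (+ (P ^ e) ℤ.- + (Q ^ e))
    Δ-suc≡ = trans
      (cong₂ (λ x y → + x ℤ.- + y) (U-suc*B-suc σ τ)
        (trans (U-suc*B-suc τ σ)
          (cong₂ (λ w t → Q ^ d + w * Q ^ e + a * t)
                 (cong (_^ r) (*-comm (B τ) (B σ))) (T*B^d-comm τ σ))))
      (pos-difference (P ^ d) (P ^ e) (Q ^ d) (Q ^ e))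

  Δ-base : ∀ {G} μ → G ∣ U μ → + (G * G) ℤ.∣ Δ (suc μ) 0
  Δ-base {G} μ G∣Uμ = subst (+ (G * G) ℤ.∣_) (sym Δ≡) (ℤ.∣ᵤ⇒∣ (∣m⇒∣m*n K G*G∣Uᵉ))
    where
    K : ℕ
    K = (U μ ^ r + B μ ^ r) * b
    G*G∣Uᵉ : G * G ∣ U μ ^ e
    G*G∣Uᵉ = ∣-trans (*-pres-∣ G∣Uμ G∣Uμ) (m*m∣m^n (U μ) 2≤e)
    add-sub : ∀ x y → (x ℤ.+ y) ℤ.- x ≡ y
    add-sub = ℤ-Solver.solve-∀
    Δ≡ : Δ (suc μ) 0 ≡ + (U μ ^ e * K)
    Δ≡ = trans (cong (λ x → + x ℤ.- + (a * B (suc μ))) (U-suc*B₀ μ))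
      (trans (cong (ℤ._- + (a * B (suc μ))) (ℤ.pos-+ (a * B (suc μ)) (U μ ^ e * K)))
        (add-sub (+ (a * B (suc μ))) (+ (U μ ^ e * K))))

  Δ-shift : ∀ {G} μ → G ∣ U μ → ∀ τ → + (G * G) ℤ.∣ Δ (τ + suc μ) τ
  Δ-shift μ G∣Uμ zero    = Δ-base μ G∣Uμ
  Δ-shift μ G∣Uμ (suc τ) = ℤ.∣-trans (Δ-shift μ G∣Uμ τ) (Δ∣Δ-suc (τ + suc μ) τ)

  Δ-cancel : ∀ {H} x y → Coprime H b → + H ℤ.∣ Δ x y → H ∣ U x → H ∣ U y
  Δ-cancel {H} x y H⊥b H∣Δ H∣Ux = coprime-divisor (coprime-^ʳ (d ^ x) H⊥b)
    (subst (H ∣_) (*-comm (U y) (B x)) (ℤ.∣⇒∣ᵤ H∣UyBx))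
    where
    sub-sub : ∀ x y → x ℤ.- (x ℤ.- y) ≡ y
    sub-sub = ℤ-Solver.solve-∀
    H∣UyBx : + H ℤ.∣ + (U y * B x)
    H∣UyBx = subst (+ H ℤ.∣_) (sub-sub (+ (U x * B y)) (+ (U y * B x)))
      (ℤ.∣m∣n⇒∣m-n (ℤ.∣ᵤ⇒∣ {i = + (U x * B y)} (∣m⇒∣m*n (B y) H∣Ux)) H∣Δ)

  ∣U-periodic : ∀ {G H} μ → G ∣ U μ → H ∣ G * G → Coprime H b →
    ∀ q τ → H ∣ U (τ + q * suc μ) → H ∣ U τ
  ∣U-periodic μ G∣Uμ H∣GG H⊥b zero τ H∣U = subst (λ k → _ ∣ U k) (+-identityʳ τ) H∣U
  ∣U-periodic {H = H} μ G∣Uμ H∣GG H⊥b (suc q) τ H∣U = ∣U-periodic μ G∣Uμ H∣GG H⊥b q τ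
    (Δ-cancel (τ′ + suc μ) τ′ H⊥b H∣Δ (subst (λ k → H ∣ U k) shift H∣U))
    where
    τ′ : ℕ
    τ′ = τ + q * suc μ
    H∣Δ : + H ℤ.∣ Δ (τ′ + suc μ) τ′
    H∣Δ = ℤ.∣-trans (ℤ.∣ᵤ⇒∣ H∣GG) (Δ-shift μ G∣Uμ τ′)
    shift : τ + (suc μ + q * suc μ) ≡ τ′ + suc μ
    shift = trans (cong (_+_ τ) (+-comm (suc μ) (q * suc μ))) (sym (+-assoc τ (q * suc μ) (suc μ)))

  ∣U-mod : ∀ {G H} μ ν → G ∣ U μ → H ∣ G * G → Coprime H b → H ∣ U ν → H ∣ U (ν % suc μ)
  ∣U-mod μ ν G∣Uμ H∣GG H⊥b H∣Uν = ∣U-periodic μ G∣Uμ H∣GG H⊥b (ν ℕ./ suc μ) (ν % suc μ)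
    (subst (λ k → _ ∣ U k) (m≡m%n+[m/n]*n ν (suc μ)) H∣Uν)

  module _ (a⊥b : Coprime a b) where

    b∣U^e*B^r+a*T : ∀ σ → b ∣ U σ ^ e * B σ ^ r + a * T σ
    b∣U^e*B^r+a*T σ = ∣m∣n⇒∣m+n
      (∣n⇒∣m*n (U σ ^ e) (∣-trans (m∣m^n b (m^n>0 d σ)) (m∣m^n (B σ) 1≤r)))
      (∣n⇒∣m*n a (m∣m^n b 1≤d^[σ+1]∸1))
      where
      1≤d^[σ+1]∸1 : 1 ≤ d ^ suc σ ∸ 1
      1≤d^[σ+1]∸1 = ∸-monoˡ-≤ 1 (≤-trans 2≤d (m≤m*n d (d ^ σ) {{m^n≢0 d σ}}))

    U⊥b : ∀ σ → Coprime (U σ) b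
    U⊥b zero    = a⊥b
    U⊥b (suc σ) {i} (i∣U , i∣b) = coprime-^ˡ d (U⊥b σ) (i∣Uᵈ , i∣b)
      where
      i∣Uᵈ : i ∣ U σ ^ d
      i∣Uᵈ = ∣m+n∣m⇒∣n
        (subst (i ∣_) (trans (+-assoc (U σ ^ d) _ _) (+-comm (U σ ^ d) _)) i∣U)
        (∣-trans i∣b (b∣U^e*B^r+a*T σ))

    rigidity : ∀ {p μ} → Prime p → IsLeast (λ σ → p ∣ U σ) μ → ∀ ν i → p ^ i ∣ U ν → p ^ i ∣ U μ
    rigidity {p} {μ} pp (p∣Uμ , none-earlier) ν i pⁱ∣Uν with p ^ i ∣? U μ
    ... | yes pⁱ∣Uμ = pⁱ∣Uμ
    ... | no pⁱ∤Uμ with j , j<i , pʲ∣Uμ , pʲ⁺¹∤Uμ ← exact-power i pⁱ∤Uμ =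
      ⊥-elim (excluded (m≤n⇒m<n∨m≡n (m<1+n⇒m≤n (m%n<n ν (suc μ)))))
      where
      1≤j : 1 ≤ j
      1≤j = n≢0⇒n>0 λ { refl → pʲ⁺¹∤Uμ (subst (_∣ U μ) (sym (^-identityʳ p)) p∣Uμ) }
      pʲ⁺¹∣Us : p ^ suc j ∣ U (ν % suc μ)
      pʲ⁺¹∣Us = ∣U-mod μ ν pʲ∣Uμ (*-monoˡ-∣ (p ^ j) (m∣m^n p 1≤j))
        (coprime-^ˡ (suc j) (coprime-∣ˡ p∣Uμ (U⊥b μ))) (∣-trans (^-monoʳ-∣ p j<i) pⁱ∣Uν)
      excluded : ν % suc μ < μ ⊎ ν % suc μ ≡ μ → ⊥
      excluded (inj₁ s<μ) = none-earlier s<μ (∣-trans (m∣m*n (p ^ j)) pʲ⁺¹∣Us)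
      excluded (inj₂ s≡μ) = pʲ⁺¹∤Uμ (subst (λ k → p ^ suc j ∣ U k) s≡μ pʲ⁺¹∣Us)

  ∏U : ℕ → ℕ
  ∏U zero    = 1
  ∏U (suc σ) = ∏U σ * U σ

  U∣∏U : ∀ {τ σ} → τ < σ → U τ ∣ ∏U σ
  U∣∏U {τ} {suc σ} τ<1+σ with m<1+n⇒m<n∨m≡n τ<1+σ
  ... | inj₁ τ<σ  = ∣m⇒∣m*n (U σ) (U∣∏U τ<σ)
  ... | inj₂ refl = n∣m*n (∏U σ)

  module _ (2≤a : 2 ≤ a) where

    ∏U<U : ∀ σ → ∏U σ < U σ
    ∏U<U zero    = 2≤a
    ∏U<U (suc σ) = <-≤-trans (*-monoˡ-< (U σ) (∏U<U σ)) U*U≤U-suc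
      where
      instance
        Uσ≢0 : NonZero (U σ)
        Uσ≢0 = >-nonZero (≤-<-trans z≤n (∏U<U σ))
      U*U≤U-suc : U σ * U σ ≤ U (suc σ)
      U*U≤U-suc = ≤-trans (m*m≤m^n (U σ) 2≤d) (≤-trans (m≤m+n _ _) (m≤m+n _ _))

    U≢0 : ∀ σ → NonZero (U σ)
    U≢0 σ = >-nonZero (≤-<-trans z≤n (∏U<U σ))

    ∏U≢0 : ∀ σ → NonZero (∏U σ)
    ∏U≢0 zero    = _
    ∏U≢0 (suc σ) = m*n≢0 (∏U σ) (U σ) {{∏U≢0 σ}} {{U≢0 σ}}

𝒵-empty : ∀ d e {c a b} .{{_ : NonZero b}} → 2 ≤ e → e < d →
  c ≃ a ÷ b → 2 ≤ a → Coprime a b → ∀ n → ¬ InZ (poly d e c) n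
𝒵-empty d e {c} {a} {b} 2≤e e<d c≃a/b 2≤a a⊥b (suc σ) (_ , no-primitive) =
  >⇒∤ {{∏U≢0 2≤a σ}} (∏U<U 2≤a σ) (prime-powers⇒∣ (U σ) (∏U σ) (U≢0 2≤a σ) earlier)
  where
  open Sequence d e a b 2≤e e<d
  ∣A∣≡U : ∀ τ → ℤ.∣ A (poly d e c) (suc τ) ∣ ≡ U τ
  ∣A∣≡U τ = ≃÷⇒∣↥∣≡ {{B≢0 τ}} (iter-≃÷ c≃a/b τ) (coprime-^ʳ (d ^ τ) (U⊥b a⊥b τ))
  earlier : PrimePowersOf U σ Divide ∏U σ
  earlier p zero    _  _      = 1∣ ∏U σ
  earlier p (suc i) pp pⁱ⁺¹∣U with least-or-none (λ τ → p ∣? U τ) σ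
  ... | inj₁ (μ , μ<σ , least) = ∣-trans (rigidity a⊥b pp least σ (suc i) pⁱ⁺¹∣U) (U∣∏U μ<σ)
  ... | inj₂ none = ⊥-elim (no-primitive p (pp , subst (p ∣_) (sym (∣A∣≡U σ)) p∣Uσ , not-earlier))
    where
    p∣Uσ : p ∣ U σ
    p∣Uσ = ∣-trans (m∣m*n (p ^ i)) pⁱ⁺¹∣U
    not-earlier : ∀ m → 1 ≤ m → m < suc σ → ¬ p ∣ ℤ.∣ A (poly d e c) m ∣
    not-earlier (suc τ) _ (s≤s τ<σ) p∣A = none τ<σ (subst (p ∣_) (∣A∣≡U τ) p∣A)

1<c⇒2≤numerator : ∀ {c} → 1ℚ <ℚ c → ∃[ a ] ℚ.↥ c ≡ + a × 2 ≤ a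
1<c⇒2≤numerator {mkℚ n b-1 _} (ℚ.*<* 1*b<n*1)
  with subst₂ ℤ._<_ (ℤ.*-identityˡ (+ suc b-1)) (ℤ.*-identityʳ n) 1*b<n*1
... | ℤ.+<+ {n = a} b<a = a , refl , ≤-trans (s≤s (s≤s z≤n)) b<a

proposition5p1 : (d e : ℕ) (c : ℚ) → e < d → e ≥ 2 → d ≥ 3 →
    1ℚ <ℚ c → c <ℚ (+ 2 / 1) →
    (n : ℕ) → InZ (poly d e c) n → n ≤ 7
proposition5p1 d e (mkℚ _ _ n⊥b) e<d e≥2 _ 1<c _ n n∈𝒵
  with a , refl , 2≤a ← 1<c⇒2≤numerator 1<c =
  ⊥-elim (𝒵-empty d e e≥2 e<d (fraction refl) 2≤a (recompute n⊥b) n n∈𝒵)
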